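{- Let $U=\{n\in\mathbb N: n\equiv 4\pmod 6\}$, $V=\{n\in\mathbb N: n \text{ odd}\}$, $W=\{n\in\mathbb N: n\equiv 2\pmod 6\}$. For $r\geq1$ let $U_r,V_r,W_r$ denote the sets of the $r$ smallest elements of $U,V,W$ respectively, and for a finite $A\subset\mathbb N$ let $[A](x)=\prod_{a\in A}(x-a)\in\mathbb Z[x]$. Let $f,g\in\mathbb Z[x]$ take the same values on $V_m$, and let $Q:U_i\cup V_m\cup W_j\to\mathbb Z$ agree with $f$ on $U_i\cup V_m$ and with $g$ on $V_m\cup W_j$. Let $k\in\mathbb N_0$. Then there is a polynomial $R\in\mathbb Z[x]$ with $R(x)=2^kQ(x)$ for all $x\in U_i\cup V_m\cup W_j$ if and only if $2^k(f-g)$ belongs to the ideal of $\mathbb Z[x]$ generated by $[U_i][V_m]$ and $[V_m][W_j]$.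
   Context: $\mathbb N=\{1,2,\dots\}$, $\mathbb N_0=\{0,1,2,\dots\}$; $i,j,m$ are positive integers. -}

module Defs where

open import Data.Nat as ℕ using (ℕ; zero; suc)
open import Data.Integer as ℤ using (ℤ; +_; 0ℤ; 1ℤ; -_)
open import Relation.Binary.PropositionalEquality using (_≡_)
open import Data.List using (List; []; _∷_; map; upTo)

-- Polynomials in ℤ[x] as coefficient lists, lowest degree first.
Poly : Set
Poly = List ℤ

coeff : Poly → ℕ → ℤ
coeff []      _       = 0ℤ
coeff (a ∷ p) zero    = a
coeff (a ∷ p) (suc n) = coeff p n

-- equality of polynomials: all coefficients agree (trailing zeros irrelevant)
infix 4 _≈ₚ_
_≈ₚ_ : Poly → Poly → Set
p ≈ₚ q = ∀ n → coeff p n ≡ coeff q n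

infixl 6 _+ₚ_ _-ₚ_
infixl 7 _*ₚ_

_+ₚ_ : Poly → Poly → Poly
[]      +ₚ q       = q
(a ∷ p) +ₚ []      = a ∷ p
(a ∷ p) +ₚ (b ∷ q) = (a ℤ.+ b) ∷ (p +ₚ q)

negₚ : Poly → Poly
negₚ = map -_

_-ₚ_ : Poly → Poly → Poly
p -ₚ q = p +ₚ negₚ q

scaleₚ : ℤ → Poly → Poly
scaleₚ c = map (c ℤ.*_)

_*ₚ_ : Poly → Poly → Poly
[]      *ₚ q = []
(a ∷ p) *ₚ q = scaleₚ a q +ₚ (0ℤ ∷ (p *ₚ q))

eval : Poly → ℤ → ℤ
eval []      x = 0ℤ
eval (a ∷ p) x = a ℤ.+ x ℤ.* eval p x

roots : List ℕ → Poly
roots []       = 1ℤ ∷ []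
roots (a ∷ as) = ((- (+ a)) ∷ 1ℤ ∷ []) *ₚ roots as

Ur : ℕ → List ℕ
Ur r = map (λ t → 6 ℕ.* t ℕ.+ 4) (upTo r)

Vr : ℕ → List ℕ
Vr r = map (λ t → 2 ℕ.* t ℕ.+ 1) (upTo r)

Wr : ℕ → List ℕ
Wr r = map (λ t → 6 ℕ.* t ℕ.+ 2) (upTo r)

-- Write c = 2^k, P₁ = [U_i][V_m], P₂ = [V_m][W_j]. If R interpolates cQ, then R − c f vanishes on
-- U_i ∪ V_m and R − c g on V_m ∪ W_j; these point sets are duplicate-free (V is odd, U and W even), so
-- by the factor theorem R − c f = A P₁ and R − c g = B P₂, whence c(f − g) = −A P₁ + B P₂.
-- Conversely, from c(f − g) = A P₁ + B P₂ the interpolant is R = c f − A P₁: it equals c f on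
-- U_i ∪ V_m, and on W_j, where P₂ vanishes, it equals c f − c(f − g) = c g.
module Submission where

open import Defs
open import Data.Nat using (ℕ; _≤_; _^_)
open import Data.Integer using (ℤ; +_; _*_)
open import Data.List using (_++_)
open import Data.List.Membership.Propositional using (_∈_)
open import Data.Product using (∃; ∃₂)
open import Function.Bundles using (_⇔_)
open import Relation.Binary.PropositionalEquality using (_≡_)

import Data.Nat as ℕ
open import Data.Nat using (zero; suc; NonZero)
import Data.Nat.Properties as ℕP
open import Data.Nat.DivMod using (_%_; [m+kn]%n≡m%n; m∣n⇒o%n%m≡o%m)
open import Data.Nat.Divisibility using (divides)
open import Data.Integer using (_+_; 0ℤ; 1ℤ; -1ℤ; -_; _-_)
import Data.Integer.Properties as ℤP
open import Data.Integer.Tactic.RingSolver using (solve-∀)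
open import Algebra.Properties.CommutativeSemigroup ℤP.+-commutativeSemigroup
  using () renaming (interchange to +-interchange)
open import Data.List using (List; []; _∷_; map; upTo)
open import Data.List.Properties using (++-assoc)
open import Data.List.Membership.Propositional.Properties using (∈-map⁻; ∈-++⁻; ∈-++⁺ˡ; ∈-++⁺ʳ)
open import Data.List.Relation.Binary.Disjoint.Propositional using (Disjoint)
open import Data.List.Relation.Unary.Any using (here; there)
open import Data.List.Relation.Unary.All as All using ()
open import Data.List.Relation.Unary.AllPairs using (_∷_)
open import Data.List.Relation.Unary.Unique.Propositional using (Unique)
open import Data.List.Relation.Unary.Unique.Propositional.Properties using (map⁺; ++⁺; upTo⁺)
open import Data.Product using (_,_)
open import Data.Sum using (inj₁; inj₂)
open import Data.Empty using (⊥-elim)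
open import Function.Bundles using (mk⇔)
open import Relation.Binary.Bundles using (Setoid)
open import Relation.Binary.Structures using (IsEquivalence)
open import Relation.Binary.PropositionalEquality
  using (_≢_; refl; sym; trans; cong; cong₂; subst; module ≡-Reasoning)
import Relation.Binary.Reasoning.Setoid as SetoidReasoning

-- A record copy of _≈ₚ_, so that both polynomials can be inferred from a proof.
infix 4 _≋_
record _≋_ (p q : Poly) : Set where
  constructor mk≋
  field coeff-≡ : ∀ n → coeff p n ≡ coeff q n
open _≋_ public

≋-isEquivalence : IsEquivalence _≋_
≋-isEquivalence = record
  { refl  = mk≋ λ _ → refl
  ; sym   = λ e → mk≋ λ n → sym (coeff-≡ e n)
  ; trans = λ e e′ → mk≋ λ n → trans (coeff-≡ e n) (coeff-≡ e′ n)
  }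

≋-setoid : Setoid _ _
≋-setoid = record { isEquivalence = ≋-isEquivalence }

open Setoid ≋-setoid public
  using () renaming (refl to ≋-refl; sym to ≋-sym; trans to ≋-trans; reflexive to ≋-reflexive)
module ≋-Reasoning = SetoidReasoning ≋-setoid

∷-cong : ∀ {a b p q} → a ≡ b → p ≋ q → a ∷ p ≋ b ∷ q
∷-cong a≡b p≋q = mk≋ λ { zero → a≡b ; (suc n) → coeff-≡ p≋q n }

[]≋0∷ : ∀ {p} → [] ≋ p → [] ≋ 0ℤ ∷ p
[]≋0∷ e = mk≋ λ { zero → refl ; (suc n) → coeff-≡ e n }

coeff-+ₚ : ∀ p q n → coeff (p +ₚ q) n ≡ coeff p n + coeff q n
coeff-+ₚ []      q       n       = sym (ℤP.+-identityˡ _)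
coeff-+ₚ (a ∷ p) []      n       = sym (ℤP.+-identityʳ _)
coeff-+ₚ (a ∷ p) (b ∷ q) zero    = refl
coeff-+ₚ (a ∷ p) (b ∷ q) (suc n) = coeff-+ₚ p q n

coeff-scaleₚ : ∀ c p n → coeff (scaleₚ c p) n ≡ c * coeff p n
coeff-scaleₚ c []      n       = sym (ℤP.*-zeroʳ c)
coeff-scaleₚ c (a ∷ p) zero    = refl
coeff-scaleₚ c (a ∷ p) (suc n) = coeff-scaleₚ c p n

coeff-negₚ : ∀ p n → coeff (negₚ p) n ≡ - coeff p n
coeff-negₚ []      n       = refl
coeff-negₚ (a ∷ p) zero    = refl
coeff-negₚ (a ∷ p) (suc n) = coeff-negₚ p n

coeff-subₚ : ∀ p q n → coeff (p -ₚ q) n ≡ coeff p n - coeff q n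
coeff-subₚ p q n = trans (coeff-+ₚ p (negₚ q) n) (cong (_+_ (coeff p n)) (coeff-negₚ q n))

+ₚ-cong : ∀ {p p′ q q′} → p ≋ p′ → q ≋ q′ → p +ₚ q ≋ p′ +ₚ q′
+ₚ-cong {p} {p′} {q} {q′} p≋p′ q≋q′ = mk≋ λ n → begin
  coeff (p +ₚ q) n         ≡⟨ coeff-+ₚ p q n ⟩
  coeff p n + coeff q n    ≡⟨ cong₂ _+_ (coeff-≡ p≋p′ n) (coeff-≡ q≋q′ n) ⟩
  coeff p′ n + coeff q′ n  ≡⟨ coeff-+ₚ p′ q′ n ⟨
  coeff (p′ +ₚ q′) n       ∎
  where open ≡-Reasoning

scaleₚ-congʳ : ∀ c {p q} → p ≋ q → scaleₚ c p ≋ scaleₚ c q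
scaleₚ-congʳ c {p} {q} p≋q = mk≋ λ n → begin
  coeff (scaleₚ c p) n  ≡⟨ coeff-scaleₚ c p n ⟩
  c * coeff p n         ≡⟨ cong (c *_) (coeff-≡ p≋q n) ⟩
  c * coeff q n         ≡⟨ coeff-scaleₚ c q n ⟨
  coeff (scaleₚ c q) n  ∎
  where open ≡-Reasoning

+ₚ-comm : ∀ p q → p +ₚ q ≋ q +ₚ p
+ₚ-comm p q = mk≋ λ n → begin
  coeff (p +ₚ q) n       ≡⟨ coeff-+ₚ p q n ⟩
  coeff p n + coeff q n  ≡⟨ ℤP.+-comm (coeff p n) (coeff q n) ⟩
  coeff q n + coeff p n  ≡⟨ coeff-+ₚ q p n ⟨
  coeff (q +ₚ p) n       ∎
  where open ≡-Reasoning

+ₚ-identityʳ : ∀ p {z} → [] ≋ z → p +ₚ z ≋ p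
+ₚ-identityʳ p {z} []≋z = mk≋ λ n → begin
  coeff (p +ₚ z) n       ≡⟨ coeff-+ₚ p z n ⟩
  coeff p n + coeff z n  ≡⟨ cong (_+_ (coeff p n)) (coeff-≡ []≋z n) ⟨
  coeff p n + 0ℤ         ≡⟨ ℤP.+-identityʳ (coeff p n) ⟩
  coeff p n              ∎
  where open ≡-Reasoning

+ₚ-interchange : ∀ p q r s → (p +ₚ q) +ₚ (r +ₚ s) ≋ (p +ₚ r) +ₚ (q +ₚ s)
+ₚ-interchange p q r s = mk≋ λ n →
  begin
    coeff ((p +ₚ q) +ₚ (r +ₚ s)) n
  ≡⟨ expand p q r s n ⟩
    (coeff p n + coeff q n) + (coeff r n + coeff s n)
  ≡⟨ +-interchange (coeff p n) (coeff q n) (coeff r n) (coeff s n) ⟩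
    (coeff p n + coeff r n) + (coeff q n + coeff s n)
  ≡⟨ expand p r q s n ⟨
    coeff ((p +ₚ r) +ₚ (q +ₚ s)) n
  ∎
  where
  open ≡-Reasoning
  expand : ∀ p q r s n → coeff ((p +ₚ q) +ₚ (r +ₚ s)) n
                       ≡ (coeff p n + coeff q n) + (coeff r n + coeff s n)
  expand p q r s n = trans (coeff-+ₚ (p +ₚ q) (r +ₚ s) n) (cong₂ _+_ (coeff-+ₚ p q n) (coeff-+ₚ r s n))

scaleₚ-zero : ∀ p → [] ≋ scaleₚ 0ℤ p
scaleₚ-zero p = mk≋ λ n → sym (trans (coeff-scaleₚ 0ℤ p n) (ℤP.*-zeroˡ (coeff p n)))

scaleₚ-assoc : ∀ c d p → scaleₚ c (scaleₚ d p) ≡ scaleₚ (c * d) p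
scaleₚ-assoc c d []      = refl
scaleₚ-assoc c d (a ∷ p) = cong₂ _∷_ (sym (ℤP.*-assoc c d a)) (scaleₚ-assoc c d p)

scaleₚ-distribʳ : ∀ c d p → scaleₚ (c + d) p ≡ scaleₚ c p +ₚ scaleₚ d p
scaleₚ-distribʳ c d []      = refl
scaleₚ-distribʳ c d (a ∷ p) = cong₂ _∷_ (ℤP.*-distribʳ-+ a c d) (scaleₚ-distribʳ c d p)

scaleₚ-distribˡ : ∀ c p q → scaleₚ c (p +ₚ q) ≡ scaleₚ c p +ₚ scaleₚ c q
scaleₚ-distribˡ c []      q       = refl
scaleₚ-distribˡ c (a ∷ p) []      = refl
scaleₚ-distribˡ c (a ∷ p) (b ∷ q) = cong₂ _∷_ (ℤP.*-distribˡ-+ c a b) (scaleₚ-distribˡ c p q)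

scaleₚ-*ₚ : ∀ c p q → scaleₚ c p *ₚ q ≡ scaleₚ c (p *ₚ q)
scaleₚ-*ₚ c []      q = refl
scaleₚ-*ₚ c (a ∷ p) q = begin
  scaleₚ (c * a) q +ₚ (0ℤ ∷ scaleₚ c p *ₚ q)             ≡⟨ cong₂ _+ₚ_ (scaleₚ-assoc c a q) (cong₂ _∷_ (ℤP.*-zeroʳ c) (sym (scaleₚ-*ₚ c p q))) ⟨
  scaleₚ c (scaleₚ a q) +ₚ (c * 0ℤ ∷ scaleₚ c (p *ₚ q))  ≡⟨ scaleₚ-distribˡ c (scaleₚ a q) (0ℤ ∷ p *ₚ q) ⟨
  scaleₚ c (scaleₚ a q +ₚ (0ℤ ∷ p *ₚ q))                 ∎
  where open ≡-Reasoning

*ₚ-congʳ : ∀ p {q q′} → q ≋ q′ → p *ₚ q ≋ p *ₚ q′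
*ₚ-congʳ []      q≋q′ = ≋-refl
*ₚ-congʳ (a ∷ p) q≋q′ = +ₚ-cong (scaleₚ-congʳ a q≋q′) (∷-cong refl (*ₚ-congʳ p q≋q′))

*ₚ-zeroʳ : ∀ p → [] ≋ p *ₚ []
*ₚ-zeroʳ []      = ≋-refl
*ₚ-zeroʳ (a ∷ p) = []≋0∷ (*ₚ-zeroʳ p)

*ₚ-identityʳ : ∀ p → p *ₚ (1ℤ ∷ []) ≋ p
*ₚ-identityʳ []      = ≋-refl
*ₚ-identityʳ (a ∷ p) = ∷-cong (trans (ℤP.+-identityʳ (a * 1ℤ)) (ℤP.*-identityʳ a)) (*ₚ-identityʳ p)

*ₚ-constʳ : ∀ p c → p *ₚ (c ∷ []) ≋ scaleₚ c p
*ₚ-constʳ []      c = ≋-refl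
*ₚ-constʳ (a ∷ p) c = ∷-cong (trans (ℤP.+-identityʳ (a * c)) (ℤP.*-comm a c)) (*ₚ-constʳ p c)

*ₚ-shiftʳ : ∀ p q → p *ₚ (0ℤ ∷ q) ≋ 0ℤ ∷ p *ₚ q
*ₚ-shiftʳ []      q = []≋0∷ ≋-refl
*ₚ-shiftʳ (a ∷ p) q =
  ∷-cong (trans (ℤP.+-identityʳ (a * 0ℤ)) (ℤP.*-zeroʳ a)) (+ₚ-cong ≋-refl (*ₚ-shiftʳ p q))

*ₚ-shiftˡ : ∀ p q → (0ℤ ∷ p) *ₚ q ≋ 0ℤ ∷ p *ₚ q
*ₚ-shiftˡ p q = ≋-trans (+ₚ-comm (scaleₚ 0ℤ q) (0ℤ ∷ p *ₚ q)) (+ₚ-identityʳ (0ℤ ∷ p *ₚ q) (scaleₚ-zero q))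

*ₚ-distribʳ : ∀ p p′ q → (p +ₚ p′) *ₚ q ≋ p *ₚ q +ₚ p′ *ₚ q
*ₚ-distribʳ []      p′       q = ≋-refl
*ₚ-distribʳ (a ∷ p) []       q = ≋-sym (+ₚ-identityʳ _ ≋-refl)
*ₚ-distribʳ (a ∷ p) (b ∷ p′) q = begin
  scaleₚ (a + b) q +ₚ (0ℤ ∷ (p +ₚ p′) *ₚ q)
    ≈⟨ +ₚ-cong (≋-reflexive (scaleₚ-distribʳ a b q)) (∷-cong refl (*ₚ-distribʳ p p′ q)) ⟩
  (scaleₚ a q +ₚ scaleₚ b q) +ₚ ((0ℤ ∷ p *ₚ q) +ₚ (0ℤ ∷ p′ *ₚ q))
    ≈⟨ +ₚ-interchange (scaleₚ a q) (scaleₚ b q) (0ℤ ∷ p *ₚ q) (0ℤ ∷ p′ *ₚ q) ⟩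
  (a ∷ p) *ₚ q +ₚ (b ∷ p′) *ₚ q
    ∎
  where open ≋-Reasoning

*ₚ-distribˡ : ∀ p q q′ → p *ₚ (q +ₚ q′) ≋ p *ₚ q +ₚ p *ₚ q′
*ₚ-distribˡ []      q q′ = ≋-refl
*ₚ-distribˡ (a ∷ p) q q′ = begin
  scaleₚ a (q +ₚ q′) +ₚ (0ℤ ∷ p *ₚ (q +ₚ q′))
    ≈⟨ +ₚ-cong (≋-reflexive (scaleₚ-distribˡ a q q′)) (∷-cong refl (*ₚ-distribˡ p q q′)) ⟩
  (scaleₚ a q +ₚ scaleₚ a q′) +ₚ ((0ℤ ∷ p *ₚ q) +ₚ (0ℤ ∷ p *ₚ q′))
    ≈⟨ +ₚ-interchange (scaleₚ a q) (scaleₚ a q′) (0ℤ ∷ p *ₚ q) (0ℤ ∷ p *ₚ q′) ⟩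
  (a ∷ p) *ₚ q +ₚ (a ∷ p) *ₚ q′
    ∎
  where open ≋-Reasoning

*ₚ-assoc : ∀ p q r → (p *ₚ q) *ₚ r ≋ p *ₚ (q *ₚ r)
*ₚ-assoc []      q r = ≋-refl
*ₚ-assoc (a ∷ p) q r = begin
  (scaleₚ a q +ₚ (0ℤ ∷ p *ₚ q)) *ₚ r
    ≈⟨ *ₚ-distribʳ (scaleₚ a q) (0ℤ ∷ p *ₚ q) r ⟩
  scaleₚ a q *ₚ r +ₚ (0ℤ ∷ p *ₚ q) *ₚ r
    ≈⟨ +ₚ-cong (≋-reflexive (scaleₚ-*ₚ a q r)) (≋-trans (*ₚ-shiftˡ (p *ₚ q) r) (∷-cong refl (*ₚ-assoc p q r))) ⟩
  scaleₚ a (q *ₚ r) +ₚ (0ℤ ∷ p *ₚ (q *ₚ r))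
    ∎
  where open ≋-Reasoning

*ₚ-comm : ∀ p q → p *ₚ q ≋ q *ₚ p
*ₚ-comm []      q = *ₚ-zeroʳ q
*ₚ-comm (a ∷ p) q = begin
  scaleₚ a q +ₚ (0ℤ ∷ p *ₚ q)     ≈⟨ +ₚ-cong ≋-refl (∷-cong refl (*ₚ-comm p q)) ⟩
  scaleₚ a q +ₚ (0ℤ ∷ q *ₚ p)     ≈⟨ +ₚ-cong (*ₚ-constʳ q a) (*ₚ-shiftʳ q p) ⟨
  q *ₚ (a ∷ []) +ₚ q *ₚ (0ℤ ∷ p)  ≈⟨ *ₚ-distribˡ q (a ∷ []) (0ℤ ∷ p) ⟨
  q *ₚ ((a ∷ []) +ₚ (0ℤ ∷ p))     ≈⟨ *ₚ-congʳ q (∷-cong (ℤP.+-identityʳ a) ≋-refl) ⟩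
  q *ₚ (a ∷ p)                    ∎
  where open ≋-Reasoning

*ₚ-congˡ : ∀ {p p′} q → p ≋ p′ → p *ₚ q ≋ p′ *ₚ q
*ₚ-congˡ {p} {p′} q p≋p′ = ≋-trans (*ₚ-comm p q) (≋-trans (*ₚ-congʳ q p≋p′) (*ₚ-comm q p′))

eval-+ₚ : ∀ p q x → eval (p +ₚ q) x ≡ eval p x + eval q x
eval-+ₚ []      q       x = sym (ℤP.+-identityˡ (eval q x))
eval-+ₚ (a ∷ p) []      x = sym (ℤP.+-identityʳ (eval (a ∷ p) x))
eval-+ₚ (a ∷ p) (b ∷ q) x rewrite eval-+ₚ p q x = regroup a b x (eval p x) (eval q x)
  where
  regroup : ∀ a b x u v → (a + b) + x * (u + v) ≡ (a + x * u) + (b + x * v)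
  regroup = solve-∀

eval-scaleₚ : ∀ c p x → eval (scaleₚ c p) x ≡ c * eval p x
eval-scaleₚ c []      x = sym (ℤP.*-zeroʳ c)
eval-scaleₚ c (a ∷ p) x rewrite eval-scaleₚ c p x = regroup c a x (eval p x)
  where
  regroup : ∀ c a x u → c * a + x * (c * u) ≡ c * (a + x * u)
  regroup = solve-∀

eval-negₚ : ∀ p x → eval (negₚ p) x ≡ - eval p x
eval-negₚ []      x = refl
eval-negₚ (a ∷ p) x rewrite eval-negₚ p x = regroup a x (eval p x)
  where
  regroup : ∀ a x u → - a + x * (- u) ≡ - (a + x * u)
  regroup = solve-∀

eval-subₚ : ∀ p q x → eval (p -ₚ q) x ≡ eval p x - eval q x
eval-subₚ p q x = trans (eval-+ₚ p (negₚ q) x) (cong (_+_ (eval p x)) (eval-negₚ q x))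

eval-*ₚ : ∀ p q x → eval (p *ₚ q) x ≡ eval p x * eval q x
eval-*ₚ []      q x = sym (ℤP.*-zeroˡ (eval q x))
eval-*ₚ (a ∷ p) q x
  rewrite eval-+ₚ (scaleₚ a q) (0ℤ ∷ p *ₚ q) x | eval-scaleₚ a q x | eval-*ₚ p q x =
  regroup a x (eval p x) (eval q x)
  where
  regroup : ∀ a x u v → a * v + (0ℤ + x * (u * v)) ≡ (a + x * u) * v
  regroup = solve-∀

eval-[]≋ : ∀ {p} x → [] ≋ p → eval p x ≡ 0ℤ
eval-[]≋ {[]}    x []≋p = refl
eval-[]≋ {b ∷ p} x []≋b∷p = begin
  b + x * eval p x  ≡⟨ cong₂ (λ c y → c + x * y) (coeff-≡ []≋b∷p zero) (sym (eval-[]≋ x []≋p)) ⟨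
  0ℤ + x * 0ℤ       ≡⟨ trans (ℤP.+-identityˡ (x * 0ℤ)) (ℤP.*-zeroʳ x) ⟩
  0ℤ                ∎
  where
  open ≡-Reasoning
  []≋p : [] ≋ p
  []≋p = mk≋ λ n → coeff-≡ []≋b∷p (suc n)

eval-cong : ∀ {p q} x → p ≋ q → eval p x ≡ eval q x
eval-cong {[]}    {q}     x p≋q = sym (eval-[]≋ x p≋q)
eval-cong {a ∷ p} {[]}    x p≋q = eval-[]≋ x (≋-sym p≋q)
eval-cong {a ∷ p} {b ∷ q} x p≋q =
  cong₂ (λ c y → c + x * y) (coeff-≡ p≋q zero) (eval-cong {p} {q} x (mk≋ λ n → coeff-≡ p≋q (suc n)))

infix 8 X-_
X-_ : ℤ → Poly
X- a = - a ∷ 1ℤ ∷ []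

eval-X- : ∀ a x → eval (X- a) x ≡ x - a
eval-X- = regroup
  where
  regroup : ∀ a x → - a + x * (1ℤ + x * 0ℤ) ≡ x - a
  regroup = solve-∀

synthetic-division : ∀ a p → ∃ λ q → p ≋ q *ₚ X- a +ₚ (eval p a ∷ [])
synthetic-division a []      = [] , []≋0∷ ≋-refl
synthetic-division a (c ∷ p) with synthetic-division a p
... | q , p≋ = eval p a ∷ q , ∷-cong (leading c a (eval p a)) (begin
  p                                          ≈⟨ p≋ ⟩
  q *ₚ X- a +ₚ (eval p a ∷ [])               ≈⟨ +ₚ-comm (q *ₚ X- a) (eval p a ∷ []) ⟩
  (eval p a ∷ []) +ₚ q *ₚ X- a
    ≈⟨ +ₚ-cong {q = q *ₚ X- a} (∷-cong {p = []} (ℤP.*-identityʳ (eval p a)) ≋-refl) ≋-refl ⟨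
  (eval p a * 1ℤ ∷ []) +ₚ q *ₚ X- a          ≈⟨ +ₚ-identityʳ _ ≋-refl ⟨
  ((eval p a * 1ℤ ∷ []) +ₚ q *ₚ X- a) +ₚ []  ∎)
  where
  open ≋-Reasoning
  leading : ∀ c a r → c ≡ (r * (- a) + 0ℤ) + (c + a * r)
  leading = solve-∀

factor-theorem : ∀ a p → eval p a ≡ 0ℤ → ∃ λ q → p ≋ q *ₚ X- a
factor-theorem a p p[a]≡0 with synthetic-division a p
... | q , p≋ rewrite p[a]≡0 = q , ≋-trans p≋ (+ₚ-identityʳ (q *ₚ X- a) ([]≋0∷ ≋-refl))

roots-vanish : ∀ L {x} → x ∈ L → eval (roots L) (+ x) ≡ 0ℤ
roots-vanish (a ∷ L) {x} (here refl) = begin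
  eval (X- + x *ₚ roots L) (+ x)              ≡⟨ eval-*ₚ (X- + x) (roots L) (+ x) ⟩
  eval (X- + x) (+ x) * eval (roots L) (+ x)  ≡⟨ cong (_* eval (roots L) (+ x)) (trans (eval-X- (+ x) (+ x)) (ℤP.+-inverseʳ (+ x))) ⟩
  0ℤ * eval (roots L) (+ x)                   ≡⟨ ℤP.*-zeroˡ (eval (roots L) (+ x)) ⟩
  0ℤ                                          ∎
  where open ≡-Reasoning
roots-vanish (a ∷ L) {x} (there x∈L) = begin
  eval (X- + a *ₚ roots L) (+ x)              ≡⟨ eval-*ₚ (X- + a) (roots L) (+ x) ⟩
  eval (X- + a) (+ x) * eval (roots L) (+ x)  ≡⟨ cong (_*_ (eval (X- + a) (+ x))) (roots-vanish L x∈L) ⟩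
  eval (X- + a) (+ x) * 0ℤ                    ≡⟨ ℤP.*-zeroʳ (eval (X- + a) (+ x)) ⟩
  0ℤ                                          ∎
  where open ≡-Reasoning

roots-++ : ∀ L M → roots (L ++ M) ≋ roots L *ₚ roots M
roots-++ []      M = begin
  roots M               ≈⟨ *ₚ-identityʳ (roots M) ⟨
  roots M *ₚ (1ℤ ∷ [])  ≈⟨ *ₚ-comm (roots M) (1ℤ ∷ []) ⟩
  (1ℤ ∷ []) *ₚ roots M  ∎
  where open ≋-Reasoning
roots-++ (a ∷ L) M = begin
  X- + a *ₚ roots (L ++ M)        ≈⟨ *ₚ-congʳ (X- + a) (roots-++ L M) ⟩
  X- + a *ₚ (roots L *ₚ roots M)  ≈⟨ *ₚ-assoc (X- + a) (roots L) (roots M) ⟨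
  (X- + a *ₚ roots L) *ₚ roots M  ∎
  where open ≋-Reasoning

vanishing⇒roots-∣ : ∀ L → Unique L → ∀ p → (∀ x → x ∈ L → eval p (+ x) ≡ 0ℤ) → ∃ λ A → p ≋ A *ₚ roots L
vanishing⇒roots-∣ []      _           p _         = p , ≋-sym (*ₚ-identityʳ p)
vanishing⇒roots-∣ (a ∷ L) (a∉L ∷ !L) p p[L]≡0 with factor-theorem (+ a) p (p[L]≡0 a (here refl))
... | q , p≋ with vanishing⇒roots-∣ L !L q q[L]≡0
  where
  -- q(x)(x − a) = p(x) = 0, and x ≠ a because a ∉ L.
  q[L]≡0 : ∀ x → x ∈ L → eval q (+ x) ≡ 0ℤ
  q[L]≡0 x x∈L with ℤP.i*j≡0⇒i≡0∨j≡0 (eval q (+ x)) (begin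
      eval q (+ x) * eval (X- + a) (+ x)  ≡⟨ eval-*ₚ q (X- + a) (+ x) ⟨
      eval (q *ₚ X- + a) (+ x)            ≡⟨ eval-cong (+ x) p≋ ⟨
      eval p (+ x)                        ≡⟨ p[L]≡0 x (there x∈L) ⟩
      0ℤ                                  ∎)
    where open ≡-Reasoning
  ... | inj₁ q[x]≡0 = q[x]≡0
  ... | inj₂ x-a≡0  = ⊥-elim (All.lookup a∉L x∈L
          (sym (ℤP.+-injective (ℤP.i-j≡0⇒i≡j (+ x) (+ a) (trans (sym (eval-X- (+ a) (+ x))) x-a≡0)))))
... | A , q≋ = A , (begin
  p                         ≈⟨ p≋ ⟩
  q *ₚ X- + a               ≈⟨ *ₚ-congˡ (X- + a) q≋ ⟩
  (A *ₚ roots L) *ₚ X- + a  ≈⟨ *ₚ-assoc A (roots L) (X- + a) ⟩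
  A *ₚ (roots L *ₚ X- + a)  ≈⟨ *ₚ-congʳ A (*ₚ-comm (roots L) (X- + a)) ⟩
  A *ₚ roots (a ∷ L)        ∎)
  where open ≋-Reasoning

roots-*ₚ-vanish : ∀ L M {x} → x ∈ L ++ M → eval (roots L *ₚ roots M) (+ x) ≡ 0ℤ
roots-*ₚ-vanish L M {x} x∈L++M =
  trans (eval-cong (+ x) (≋-sym (roots-++ L M))) (roots-vanish (L ++ M) x∈L++M)

eval-*ₚ-vanish : ∀ A P x → eval P x ≡ 0ℤ → eval (A *ₚ P) x ≡ 0ℤ
eval-*ₚ-vanish A P x P[x]≡0 =
  trans (eval-*ₚ A P x) (trans (cong (_*_ (eval A x)) P[x]≡0) (ℤP.*-zeroʳ (eval A x)))

scaleₚ-difference : ∀ c f g R → scaleₚ c (f -ₚ g) ≋ scaleₚ -1ℤ (R -ₚ scaleₚ c f) +ₚ (R -ₚ scaleₚ c g)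
scaleₚ-difference c f g R = mk≋ λ n → begin
  coeff (scaleₚ c (f -ₚ g)) n
    ≡⟨ trans (coeff-scaleₚ c (f -ₚ g) n) (cong (_*_ c) (coeff-subₚ f g n)) ⟩
  c * (coeff f n - coeff g n)
    ≡⟨ regroup c (coeff f n) (coeff g n) (coeff R n) ⟩
  -1ℤ * (coeff R n - c * coeff f n) + (coeff R n - c * coeff g n)
    ≡⟨ cong₂ _+_ (cong (_*_ -1ℤ) (remainder f n)) (remainder g n) ⟨
  -1ℤ * coeff (R -ₚ scaleₚ c f) n + coeff (R -ₚ scaleₚ c g) n
    ≡⟨ cong (_+ coeff (R -ₚ scaleₚ c g) n) (coeff-scaleₚ -1ℤ (R -ₚ scaleₚ c f) n) ⟨
  coeff (scaleₚ -1ℤ (R -ₚ scaleₚ c f)) n + coeff (R -ₚ scaleₚ c g) n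
    ≡⟨ coeff-+ₚ (scaleₚ -1ℤ (R -ₚ scaleₚ c f)) (R -ₚ scaleₚ c g) n ⟨
  coeff (scaleₚ -1ℤ (R -ₚ scaleₚ c f) +ₚ (R -ₚ scaleₚ c g)) n
    ∎
  where
  open ≡-Reasoning
  regroup : ∀ c f g r → c * (f - g) ≡ -1ℤ * (r - c * f) + (r - c * g)
  regroup = solve-∀
  remainder : ∀ h n → coeff (R -ₚ scaleₚ c h) n ≡ coeff R n - c * coeff h n
  remainder h n = trans (coeff-subₚ R (scaleₚ c h) n) (cong (_-_ (coeff R n)) (coeff-scaleₚ c h n))

module _ (c : ℤ) (U V W : List ℕ) (f g : Poly) (Q : ℕ → ℤ)
         (Q≡f : ∀ x → x ∈ U ++ V → Q x ≡ eval f (+ x))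
         (Q≡g : ∀ x → x ∈ V ++ W → Q x ≡ eval g (+ x)) where

  private
    P₁ P₂ : Poly
    P₁ = roots U *ₚ roots V
    P₂ = roots V *ₚ roots W

  factors⇒ideal : ∀ R A B → R -ₚ scaleₚ c f ≋ A *ₚ roots (U ++ V) → R -ₚ scaleₚ c g ≋ B *ₚ roots (V ++ W) →
    scaleₚ c (f -ₚ g) ≋ scaleₚ -1ℤ A *ₚ P₁ +ₚ B *ₚ P₂
  factors⇒ideal R A B R-cf≋ R-cg≋ = begin
    scaleₚ c (f -ₚ g)                                  ≈⟨ scaleₚ-difference c f g R ⟩
    scaleₚ -1ℤ (R -ₚ scaleₚ c f) +ₚ (R -ₚ scaleₚ c g)  ≈⟨ +ₚ-cong (scaleₚ-congʳ -1ℤ R-cf≋) R-cg≋ ⟩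
    scaleₚ -1ℤ (A *ₚ roots (U ++ V)) +ₚ B *ₚ roots (V ++ W)
      ≈⟨ +ₚ-cong (scaleₚ-congʳ -1ℤ (*ₚ-congʳ A (roots-++ U V))) (*ₚ-congʳ B (roots-++ V W)) ⟩
    scaleₚ -1ℤ (A *ₚ P₁) +ₚ B *ₚ P₂  ≈⟨ +ₚ-cong (≋-reflexive (scaleₚ-*ₚ -1ℤ A P₁)) ≋-refl ⟨
    scaleₚ -1ℤ A *ₚ P₁ +ₚ B *ₚ P₂    ∎
    where open ≋-Reasoning

  interpolant⇒ideal : Unique (U ++ V) → Unique (V ++ W) →
    (∃ λ R → ∀ x → x ∈ U ++ V ++ W → eval R (+ x) ≡ c * Q x) →
    ∃₂ λ A B → scaleₚ c (f -ₚ g) ≈ₚ A *ₚ P₁ +ₚ B *ₚ P₂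
  interpolant⇒ideal !UV !VW (R , R≡cQ) =
    let A , R-cf≋ = vanishing⇒roots-∣ (U ++ V) !UV (R -ₚ scaleₚ c f) (remainder-vanish f (U ++ V) R≡cf)
        B , R-cg≋ = vanishing⇒roots-∣ (V ++ W) !VW (R -ₚ scaleₚ c g) (remainder-vanish g (V ++ W) R≡cg)
    in scaleₚ -1ℤ A , B , coeff-≡ (factors⇒ideal R A B R-cf≋ R-cg≋)
    where
    R≡cf : ∀ x → x ∈ U ++ V → eval R (+ x) ≡ c * eval f (+ x)
    R≡cf x x∈UV = trans (R≡cQ x (subst (x ∈_) (++-assoc U V W) (∈-++⁺ˡ x∈UV))) (cong (_*_ c) (Q≡f x x∈UV))
    R≡cg : ∀ x → x ∈ V ++ W → eval R (+ x) ≡ c * eval g (+ x)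
    R≡cg x x∈VW = trans (R≡cQ x (∈-++⁺ʳ U x∈VW)) (cong (_*_ c) (Q≡g x x∈VW))
    remainder-vanish : ∀ h S → (∀ x → x ∈ S → eval R (+ x) ≡ c * eval h (+ x)) →
                       ∀ x → x ∈ S → eval (R -ₚ scaleₚ c h) (+ x) ≡ 0ℤ
    remainder-vanish h S R≡ch x x∈S = begin
      eval (R -ₚ scaleₚ c h) (+ x)            ≡⟨ eval-subₚ R (scaleₚ c h) (+ x) ⟩
      eval R (+ x) - eval (scaleₚ c h) (+ x)  ≡⟨ cong₂ _-_ (R≡ch x x∈S) (eval-scaleₚ c h (+ x)) ⟩
      c * eval h (+ x) - c * eval h (+ x)     ≡⟨ ℤP.+-inverseʳ (c * eval h (+ x)) ⟩
      0ℤ                                      ∎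
      where open ≡-Reasoning

  ideal⇒interpolant : (∃₂ λ A B → scaleₚ c (f -ₚ g) ≈ₚ A *ₚ P₁ +ₚ B *ₚ P₂) →
    ∃ λ R → ∀ x → x ∈ U ++ V ++ W → eval R (+ x) ≡ c * Q x
  ideal⇒interpolant (A , B , c[f-g]≈) = scaleₚ c f -ₚ A *ₚ P₁ , R≡cQ
    where
    eval-R : ∀ x → eval (scaleₚ c f -ₚ A *ₚ P₁) x ≡ c * eval f x - eval (A *ₚ P₁) x
    eval-R x = trans (eval-subₚ (scaleₚ c f) (A *ₚ P₁) x) (cong (_- eval (A *ₚ P₁) x) (eval-scaleₚ c f x))
    R≡cQ : ∀ x → x ∈ U ++ V ++ W → eval (scaleₚ c f -ₚ A *ₚ P₁) (+ x) ≡ c * Q x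
    R≡cQ x x∈UVW with ∈-++⁻ (U ++ V) (subst (x ∈_) (sym (++-assoc U V W)) x∈UVW)
    ... | inj₁ x∈UV = begin
      eval (scaleₚ c f -ₚ A *ₚ P₁) (+ x)  ≡⟨ eval-R (+ x) ⟩
      c * F - eval (A *ₚ P₁) (+ x)        ≡⟨ cong (_-_ (c * F)) (eval-*ₚ-vanish A P₁ (+ x) (roots-*ₚ-vanish U V x∈UV)) ⟩
      c * F - 0ℤ                          ≡⟨ ℤP.+-identityʳ (c * F) ⟩
      c * F                               ≡⟨ cong (_*_ c) (Q≡f x x∈UV) ⟨
      c * Q x                             ∎
      where
      open ≡-Reasoning
      F : ℤ
      F = eval f (+ x)
    ... | inj₂ x∈W = begin
      eval (scaleₚ c f -ₚ A *ₚ P₁) (+ x)  ≡⟨ eval-R (+ x) ⟩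
      c * F - eval (A *ₚ P₁) (+ x)        ≡⟨ cong (_-_ (c * F)) AP₁[x]≡c[F-G] ⟩
      c * F - c * (F - G)                 ≡⟨ regroup c F G ⟩
      c * G                               ≡⟨ cong (_*_ c) (Q≡g x (∈-++⁺ʳ V x∈W)) ⟨
      c * Q x                             ∎
      where
      open ≡-Reasoning
      F G : ℤ
      F = eval f (+ x)
      G = eval g (+ x)
      regroup : ∀ c F G → c * F - c * (F - G) ≡ c * G
      regroup = solve-∀
      AP₁[x]≡c[F-G] : eval (A *ₚ P₁) (+ x) ≡ c * (F - G)
      AP₁[x]≡c[F-G] = begin
        eval (A *ₚ P₁) (+ x)                         ≡⟨ ℤP.+-identityʳ (eval (A *ₚ P₁) (+ x)) ⟨
        eval (A *ₚ P₁) (+ x) + 0ℤ                    ≡⟨ cong (_+_ (eval (A *ₚ P₁) (+ x))) (eval-*ₚ-vanish B P₂ (+ x) (roots-*ₚ-vanish V W (∈-++⁺ʳ V x∈W))) ⟨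
        eval (A *ₚ P₁) (+ x) + eval (B *ₚ P₂) (+ x)  ≡⟨ eval-+ₚ (A *ₚ P₁) (B *ₚ P₂) (+ x) ⟨
        eval (A *ₚ P₁ +ₚ B *ₚ P₂) (+ x)              ≡⟨ eval-cong {scaleₚ c (f -ₚ g)} {A *ₚ P₁ +ₚ B *ₚ P₂} (+ x) (mk≋ c[f-g]≈) ⟨
        eval (scaleₚ c (f -ₚ g)) (+ x)               ≡⟨ eval-scaleₚ c (f -ₚ g) (+ x) ⟩
        c * eval (f -ₚ g) (+ x)                      ≡⟨ cong (_*_ c) (eval-subₚ f g (+ x)) ⟩
        c * (F - G)                                  ∎

affine-injective : ∀ n r .{{_ : NonZero n}} {s t} → n ℕ.* s ℕ.+ r ≡ n ℕ.* t ℕ.+ r → s ≡ t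
affine-injective n r {s} {t} eq = ℕP.*-cancelˡ-≡ s t n (ℕP.+-cancelʳ-≡ r (n ℕ.* s) (n ℕ.* t) eq)

affine-unique : ∀ n r .{{_ : NonZero n}} k → Unique (map (λ t → n ℕ.* t ℕ.+ r) (upTo k))
affine-unique n r k = map⁺ (affine-injective n r) (upTo⁺ k)

affine-residue : ∀ n r .{{_ : NonZero n}} {xs x} → x ∈ map (λ t → n ℕ.* t ℕ.+ r) xs → x % n ≡ r % n
affine-residue n r {xs} x∈ with ∈-map⁻ (λ t → n ℕ.* t ℕ.+ r) x∈
... | t , _ , refl = trans (cong (_% n) (trans (ℕP.+-comm (n ℕ.* t) r) (cong (r ℕ.+_) (ℕP.*-comm n t))))
                           ([m+kn]%n≡m%n r t n)

residue-disjoint : ∀ n .{{_ : NonZero n}} {a b xs ys} → a ≢ b →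
  (∀ {x} → x ∈ xs → x % n ≡ a) → (∀ {x} → x ∈ ys → x % n ≡ b) → Disjoint xs ys
residue-disjoint n a≢b xs≡a ys≡b (x∈xs , x∈ys) = a≢b (trans (sym (xs≡a x∈xs)) (ys≡b x∈ys))

mod6⇒mod2 : ∀ x {r} → x % 6 ≡ r → x % 2 ≡ r % 2
mod6⇒mod2 x refl = sym (m∣n⇒o%n%m≡o%m 2 6 x (divides 3 refl))

Ur-Vr-unique : ∀ i m → Unique (Ur i ++ Vr m)
Ur-Vr-unique i m = ++⁺ (affine-unique 6 4 i) (affine-unique 2 1 m)
  (residue-disjoint 2 (λ ()) (λ {x} x∈ → mod6⇒mod2 x (affine-residue 6 4 x∈)) (affine-residue 2 1))

Vr-Wr-unique : ∀ m j → Unique (Vr m ++ Wr j)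
Vr-Wr-unique m j = ++⁺ (affine-unique 2 1 m) (affine-unique 6 2 j)
  (residue-disjoint 2 (λ ()) (affine-residue 2 1) (λ {x} x∈ → mod6⇒mod2 x (affine-residue 6 2 x∈)))

mainTheorem7 : (i j m : ℕ) → 1 ≤ i → 1 ≤ j → 1 ≤ m →
    (f g : Poly) → (Q : ℕ → ℤ) → (k : ℕ) →
    (∀ x → x ∈ Vr m → eval f (+ x) ≡ eval g (+ x)) →
    (∀ x → x ∈ Ur i ++ Vr m → Q x ≡ eval f (+ x)) →
    (∀ x → x ∈ Vr m ++ Wr j → Q x ≡ eval g (+ x)) →
    (∃ λ (R : Poly) → ∀ x → x ∈ Ur i ++ Vr m ++ Wr j → eval R (+ x) ≡ (+ (2 ^ k)) * Q x)
    ⇔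
    (∃₂ λ (A B : Poly) →
      scaleₚ (+ (2 ^ k)) (f -ₚ g) ≈ₚ A *ₚ (roots (Ur i) *ₚ roots (Vr m)) +ₚ B *ₚ (roots (Vr m) *ₚ roots (Wr j)))
mainTheorem7 i j m _ _ _ f g Q k _ Q≡f Q≡g = mk⇔
  (interpolant⇒ideal c (Ur i) (Vr m) (Wr j) f g Q Q≡f Q≡g (Ur-Vr-unique i m) (Vr-Wr-unique m j))
  (ideal⇒interpolant c (Ur i) (Vr m) (Wr j) f g Q Q≡f Q≡g)
  where
  c : ℤ
  c = + (2 ^ k)
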